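{- Let $T$ and $T'$ be vertex-disjoint triangles in a graph $G$. Then either the vertices can be labelled $T=x_3x_1x_2$ and $T'=y_1y_2y_3$ so that $x_3x_1x_2y_1y_2y_3$ is a square path, or there exist distinct vertices $x_1,x_2\in V(T)$ and distinct $y_1,y_2\in V(T')$ such that $x_1\not\sim y_1$ and $x_2\not\sim y_2$.
   Context: A square path $v_1v_2\dots v_k$ is a sequence of distinct vertices such that $v_iv_j$ is an edge whenever $1\le|i-j|\le2$. $u\not\sim v$ means $uv$ is not an edge. -}

module Defs where

open import Data.Nat using (ℕ; _≤_; ∣_-_∣)
open import Data.Fin using (Fin; toℕ)
open import Data.Vec using (Vec; lookup)
open import Data.Product using (_×_)
open import Data.Sum using (_⊎_)
open import Relation.Nullary using (¬_; Dec)
open import Relation.Binary.PropositionalEquality using (_≡_)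
open import Function.Definitions using (Injective)

record Graph (n : ℕ) : Set₁ where
  field
    Adj    : Fin n → Fin n → Set
    adj?   : ∀ u v → Dec (Adj u v)
    sym    : ∀ {u v} → Adj u v → Adj v u
    irrefl : ∀ {u} → ¬ Adj u u

-- A triangle: three mutually adjacent vertices (distinct by irreflexivity).
record Triangle {n : ℕ} (G : Graph n) : Set where
  open Graph G
  field
    a b c : Fin n
    ab : Adj a b
    bc : Adj b c
    ac : Adj a c

_∈T_ : ∀ {n} {G : Graph n} → Fin n → Triangle G → Set
v ∈T T = v ≡ Triangle.a T ⊎ v ≡ Triangle.b T ⊎ v ≡ Triangle.c T

Disjoint : ∀ {n} {G : Graph n} → Triangle G → Triangle G → Set
Disjoint T T' = ∀ v → v ∈T T → ¬ (v ∈T T')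

-- (x , y , z) is a labelling of the vertices of T: distinct vertices of T
-- (hence exactly V(T), since |V(T)| = 3)
Labelling : ∀ {n} {G : Graph n} → Triangle G → Fin n → Fin n → Fin n → Set
Labelling T x y z =
  (x ∈T T) × (y ∈T T) × (z ∈T T) × ¬ (x ≡ y) × ¬ (y ≡ z) × ¬ (x ≡ z)

SquarePath : ∀ {n} → Graph n → ∀ {k} → Vec (Fin n) k → Set
SquarePath G {k} vs =
  Injective _≡_ _≡_ (lookup vs) ×
  (∀ (i j : Fin k) → 1 ≤ ∣ toℕ i - toℕ j ∣ → ∣ toℕ i - toℕ j ∣ ≤ 2 →
     Graph.Adj G (lookup vs i) (lookup vs j))

-- Let H be the bipartite graph of edges between T and T'.  If the non-edges of
-- H contain no matching of size two, then by König's theorem they are all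
-- incident with a single vertex; labelling that vertex x₃ (or y₃) leaves the
-- three edges x₁y₁, x₂y₁, x₂y₂ present, and these together with the two
-- triangles are exactly the edges a square path x₃x₁x₂y₁y₂y₃ requires.
module Submission where

open import Defs
open import Data.Nat using (ℕ; suc; s≤s; _≤_; ∣_-_∣)
open import Data.Fin using (Fin; zero; suc; toℕ)
open import Data.Vec using (Vec; _∷_; []; lookup)
open import Data.Vec.Relation.Unary.All using (All; _∷_; [])
open import Data.Vec.Relation.Unary.All.Properties using (lookup⁺)
open import Data.Product using (_×_; ∃-syntax; _,_)
open import Data.Sum using (_⊎_; inj₁; inj₂; map₁)
open import Function using (_$_)
open import Relation.Nullary using (¬_; yes; no; contradiction)
open import Relation.Binary.PropositionalEquality
  using (_≡_; _≢_; refl; cong; ≢-sym) renaming (sym to ≡-sym)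

data Perm₃ {A : Set} (a b c : A) : A → A → A → Set where
  abc : Perm₃ a b c a b c
  acb : Perm₃ a b c a c b
  bac : Perm₃ a b c b a c
  bca : Perm₃ a b c b c a
  cab : Perm₃ a b c c a b
  cba : Perm₃ a b c c b a

module _ {n : ℕ} {G : Graph n} where
  open Graph G using (Adj; adj?; irrefl) renaming (sym to adj-sym)

  adj⇒≢ : ∀ {u v} → Adj u v → u ≢ v
  adj⇒≢ uv refl = irrefl uv

  ∈T-adj : (T : Triangle G) → ∀ {u v} → u ∈T T → v ∈T T → u ≢ v → Adj u v
  ∈T-adj T (inj₁ refl)        (inj₁ refl)        u≢v = contradiction refl u≢v
  ∈T-adj T (inj₁ refl)        (inj₂ (inj₁ refl)) _   = Triangle.ab T
  ∈T-adj T (inj₁ refl)        (inj₂ (inj₂ refl)) _   = Triangle.ac T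
  ∈T-adj T (inj₂ (inj₁ refl)) (inj₁ refl)        _   = adj-sym (Triangle.ab T)
  ∈T-adj T (inj₂ (inj₁ refl)) (inj₂ (inj₁ refl)) u≢v = contradiction refl u≢v
  ∈T-adj T (inj₂ (inj₁ refl)) (inj₂ (inj₂ refl)) _   = Triangle.bc T
  ∈T-adj T (inj₂ (inj₂ refl)) (inj₁ refl)        _   = adj-sym (Triangle.ac T)
  ∈T-adj T (inj₂ (inj₂ refl)) (inj₂ (inj₁ refl)) _   = adj-sym (Triangle.bc T)
  ∈T-adj T (inj₂ (inj₂ refl)) (inj₂ (inj₂ refl)) u≢v = contradiction refl u≢v

  disjoint⇒≢ : ∀ {T T' : Triangle G} → Disjoint T T' →
               ∀ {u v} → u ∈T T → v ∈T T' → u ≢ v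
  disjoint⇒≢ disj {u} u∈T v∈T' refl = disj u u∈T v∈T'

  labelling-swap₁₂ : ∀ {T : Triangle G} {x y z} → Labelling T x y z → Labelling T y x z
  labelling-swap₁₂ (x∈ , y∈ , z∈ , x≢y , y≢z , x≢z) =
    y∈ , x∈ , z∈ , ≢-sym x≢y , x≢z , y≢z

  labelling-swap₂₃ : ∀ {T : Triangle G} {x y z} → Labelling T x y z → Labelling T x z y
  labelling-swap₂₃ (x∈ , y∈ , z∈ , x≢y , y≢z , x≢z) =
    x∈ , z∈ , y∈ , x≢z , ≢-sym y≢z , x≢y

  triangle-labelling-abc : (T : Triangle G) → let open Triangle T in Labelling T a b c
  triangle-labelling-abc T = inj₁ refl , inj₂ (inj₁ refl) , inj₂ (inj₂ refl) ,
                             adj⇒≢ (Triangle.ab T) , adj⇒≢ (Triangle.bc T) , adj⇒≢ (Triangle.ac T)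

  triangle-labelling : (T : Triangle G) → let open Triangle T in
    ∀ {x y z} → Perm₃ a b c x y z → Labelling T x y z
  triangle-labelling T abc = triangle-labelling-abc T
  triangle-labelling T acb = labelling-swap₂₃ {T} (triangle-labelling-abc T)
  triangle-labelling T bac = labelling-swap₁₂ {T} (triangle-labelling-abc T)
  triangle-labelling T bca = labelling-swap₂₃ {T} (labelling-swap₁₂ {T} (triangle-labelling-abc T))
  triangle-labelling T cab = labelling-swap₁₂ {T} (labelling-swap₂₃ {T} (triangle-labelling-abc T))
  triangle-labelling T cba =
    labelling-swap₁₂ {T} (labelling-swap₂₃ {T} (labelling-swap₁₂ {T} (triangle-labelling-abc T)))

  squarePath-pair : ∀ {x y} → Adj x y → SquarePath G (x ∷ y ∷ [])
  squarePath-pair {x} {y} xy = injective , adjacent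
    where
    injective : ∀ {i j} → lookup (x ∷ y ∷ []) i ≡ lookup (x ∷ y ∷ []) j → i ≡ j
    injective {zero}     {zero}     _ = refl
    injective {zero}     {suc zero} e = contradiction e (adj⇒≢ xy)
    injective {suc zero} {zero}     e = contradiction (≡-sym e) (adj⇒≢ xy)
    injective {suc zero} {suc zero} _ = refl

    adjacent : ∀ i j → 1 ≤ ∣ toℕ i - toℕ j ∣ → ∣ toℕ i - toℕ j ∣ ≤ 2 →
               Adj (lookup (x ∷ y ∷ []) i) (lookup (x ∷ y ∷ []) j)
    adjacent zero       zero       () _
    adjacent zero       (suc zero) _  _ = xy
    adjacent (suc zero) zero       _  _ = adj-sym xy
    adjacent (suc zero) (suc zero) () _

  squarePath-cons : ∀ {k x y z} {vs : Vec (Fin n) k} →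
    All (x ≢_) (y ∷ z ∷ vs) → Adj x y → Adj x z →
    SquarePath G (y ∷ z ∷ vs) → SquarePath G (x ∷ y ∷ z ∷ vs)
  squarePath-cons {k} {x} {y} {z} {vs} fresh xy xz (inj , adj) = injective , adjacent
    where
    ws : Vec (Fin n) (suc (suc (suc k)))
    ws = x ∷ y ∷ z ∷ vs

    injective : ∀ {i j} → lookup ws i ≡ lookup ws j → i ≡ j
    injective {zero}  {zero}  _ = refl
    injective {zero}  {suc j} e = contradiction e (lookup⁺ fresh j)
    injective {suc i} {zero}  e = contradiction (≡-sym e) (lookup⁺ fresh i)
    injective {suc i} {suc j} e = cong suc (inj e)

    adjacent : ∀ i j → 1 ≤ ∣ toℕ i - toℕ j ∣ → ∣ toℕ i - toℕ j ∣ ≤ 2 →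
               Adj (lookup ws i) (lookup ws j)
    adjacent zero                zero                ()  _
    adjacent zero                (suc zero)          _   _ = xy
    adjacent zero                (suc (suc zero))    _   _ = xz
    adjacent zero                (suc (suc (suc _))) _   (s≤s (s≤s ()))
    adjacent (suc zero)          zero                _   _ = adj-sym xy
    adjacent (suc (suc zero))    zero                _   _ = adj-sym xz
    adjacent (suc (suc (suc _))) zero                _   (s≤s (s≤s ()))
    adjacent (suc i)             (suc j)             p   q = adj i j p q

  CrossPath : Triangle G → Triangle G → Set
  CrossPath T T' = ∃[ x₁ ] ∃[ x₂ ] ∃[ x₃ ] ∃[ y₁ ] ∃[ y₂ ] ∃[ y₃ ]
    (Labelling T x₃ x₁ x₂ × Labelling T' y₁ y₂ y₃ × Adj x₁ y₁ × Adj x₂ y₁ × Adj x₂ y₂)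

  AntiMatching : Triangle G → Triangle G → Set
  AntiMatching T T' = ∃[ x₁ ] ∃[ x₂ ] ∃[ y₁ ] ∃[ y₂ ]
    (x₁ ∈T T × x₂ ∈T T × ¬ (x₁ ≡ x₂) ×
     y₁ ∈T T' × y₂ ∈T T' × ¬ (y₁ ≡ y₂) ×
     ¬ Adj x₁ y₁ × ¬ Adj x₂ y₂)

  module _ (T T' : Triangle G) where
    open Triangle T using (a; b; c)
    open Triangle T' using () renaming (a to a'; b to b'; c to c')

    private
      path : ∀ {x₁ x₂ x₃ y₁ y₂ y₃} → Perm₃ a b c x₃ x₁ x₂ → Perm₃ a' b' c' y₁ y₂ y₃ →
             Adj x₁ y₁ → Adj x₂ y₁ → Adj x₂ y₂ → CrossPath T T' ⊎ AntiMatching T T'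
      path σ τ x₁y₁ x₂y₁ x₂y₂ =
        inj₁ (_ , _ , _ , _ , _ , _ , triangle-labelling T σ , triangle-labelling T' τ ,
              x₁y₁ , x₂y₁ , x₂y₂)

      anti : ∀ {x₁ x₂ x₃ y₁ y₂ y₃} → Perm₃ a b c x₁ x₂ x₃ → Perm₃ a' b' c' y₁ y₂ y₃ →
             ¬ Adj x₁ y₁ → ¬ Adj x₂ y₂ → CrossPath T T' ⊎ AntiMatching T T'
      anti σ τ ¬x₁y₁ ¬x₂y₂ with triangle-labelling T σ | triangle-labelling T' τ
      ... | x₁∈ , x₂∈ , _ , x₁≢x₂ , _ | y₁∈ , y₂∈ , _ , y₁≢y₂ , _ =
        inj₂ (_ , _ , _ , _ , x₁∈ , x₂∈ , x₁≢x₂ , y₁∈ , y₂∈ , y₁≢y₂ , ¬x₁y₁ , ¬x₂y₂)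

    crossPath-or-antiMatching : CrossPath T T' ⊎ AntiMatching T T'
    crossPath-or-antiMatching
      with adj? a a' | adj? a b' | adj? b a' | adj? b b' | adj? b c' | adj? c b'
    ... | yes aa' | yes ab' | yes ba' | _       | _       | _       = path cba abc ba' aa' ab'
    ... | yes aa' | yes ab' | no ¬ba' | _       | _       | yes cb' = path bca bac cb' ab' aa'
    ... | yes _   | yes _   | no ¬ba' | _       | _       | no ¬cb' = anti bca abc ¬ba' ¬cb'
    ... | yes aa' | no ¬ab' | yes ba' | _       | yes bc' | _       = path cab acb aa' ba' bc'
    ... | yes _   | no ¬ab' | yes _   | _       | no ¬bc' | _       = anti abc bca ¬ab' ¬bc'
    ... | yes _   | no ¬ab' | no ¬ba' | _       | _       | _       = anti abc bac ¬ab' ¬ba'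
    ... | no ¬aa' | _       | _       | yes bb' | yes bc' | yes cb' = path acb bca cb' bb' bc'
    ... | no ¬aa' | _       | _       | yes _   | yes _   | no ¬cb' = anti acb abc ¬aa' ¬cb'
    ... | no ¬aa' | _       | _       | yes _   | no ¬bc' | _       = anti abc acb ¬aa' ¬bc'
    ... | no ¬aa' | _       | _       | no ¬bb' | _       | _       = anti abc abc ¬aa' ¬bb'

    crossPath⇒squarePath : Disjoint T T' → CrossPath T T' →
      ∃[ x₁ ] ∃[ x₂ ] ∃[ x₃ ] ∃[ y₁ ] ∃[ y₂ ] ∃[ y₃ ]
        (Labelling T x₃ x₁ x₂ × Labelling T' y₁ y₂ y₃ ×
         SquarePath G (x₃ ∷ x₁ ∷ x₂ ∷ y₁ ∷ y₂ ∷ y₃ ∷ []))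
    crossPath⇒squarePath disj
      (x₁ , x₂ , x₃ , y₁ , y₂ , y₃ , σ@(x₃∈ , x₁∈ , x₂∈ , x₃≢x₁ , x₁≢x₂ , x₃≢x₂)
                                   , τ@(y₁∈ , y₂∈ , y₃∈ , y₁≢y₂ , y₂≢y₃ , y₁≢y₃)
                                   , x₁y₁ , x₂y₁ , x₂y₂) =
      x₁ , x₂ , x₃ , y₁ , y₂ , y₃ , σ , τ ,
        (squarePath-cons (x₃≢x₁ ∷ x₃≢x₂ ∷ apart x₃∈) x₃x₁ x₃x₂ $
         squarePath-cons (x₁≢x₂ ∷ apart x₁∈) x₁x₂ x₁y₁ $
         squarePath-cons (apart x₂∈) x₂y₁ x₂y₂ $
         squarePath-cons (y₁≢y₂ ∷ y₁≢y₃ ∷ []) y₁y₂ y₁y₃ $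
         squarePath-pair y₂y₃)
      where
      x₃x₁ : Adj x₃ x₁
      x₃x₁ = ∈T-adj T x₃∈ x₁∈ x₃≢x₁
      x₃x₂ : Adj x₃ x₂
      x₃x₂ = ∈T-adj T x₃∈ x₂∈ x₃≢x₂
      x₁x₂ : Adj x₁ x₂
      x₁x₂ = ∈T-adj T x₁∈ x₂∈ x₁≢x₂
      y₁y₂ : Adj y₁ y₂
      y₁y₂ = ∈T-adj T' y₁∈ y₂∈ y₁≢y₂
      y₁y₃ : Adj y₁ y₃
      y₁y₃ = ∈T-adj T' y₁∈ y₃∈ y₁≢y₃
      y₂y₃ : Adj y₂ y₃
      y₂y₃ = ∈T-adj T' y₂∈ y₃∈ y₂≢y₃

      apart : ∀ {u} → u ∈T T → All (u ≢_) (y₁ ∷ y₂ ∷ y₃ ∷ [])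
      apart {u} u∈ = u≢ y₁∈ ∷ u≢ y₂∈ ∷ u≢ y₃∈ ∷ []
        where
        u≢ : ∀ {v} → v ∈T T' → u ≢ v
        u≢ = disjoint⇒≢ {T} {T'} disj u∈

fact3p8 : ∀ {n} (G : Graph n) (T T' : Triangle G) → Disjoint T T' →
    (∃[ x₁ ] ∃[ x₂ ] ∃[ x₃ ] ∃[ y₁ ] ∃[ y₂ ] ∃[ y₃ ]
        (Labelling T x₃ x₁ x₂ × Labelling T' y₁ y₂ y₃ ×
         SquarePath G (x₃ ∷ x₁ ∷ x₂ ∷ y₁ ∷ y₂ ∷ y₃ ∷ [])))
    ⊎
    (∃[ x₁ ] ∃[ x₂ ] ∃[ y₁ ] ∃[ y₂ ]
        (x₁ ∈T T × x₂ ∈T T × ¬ (x₁ ≡ x₂) ×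
         y₁ ∈T T' × y₂ ∈T T' × ¬ (y₁ ≡ y₂) ×
         ¬ Graph.Adj G x₁ y₁ × ¬ Graph.Adj G x₂ y₂))
fact3p8 G T T' disj = map₁ (crossPath⇒squarePath T T' disj) (crossPath-or-antiMatching T T')
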